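{- Let $k\ge 6$ be an integer and let $G$ be a graph with $ch_3^d(G)>k$ having the smallest number of vertices and edges among all graphs with list 3-dynamic chromatic number greater than $k$. Then neither of the following two configurations occurs in $G$ as an induced subgraph. (a) Eight distinct vertices $v_1,v_2,v_3,v_4,v_5,w,u,x$ such that the edges of $G$ among them are exactly $v_1v_2,v_2v_3,v_3v_4,v_4v_5,v_5v_1,v_1w,wu,v_2x$, with $\deg_G(v_1)=\deg_G(v_2)=3$, $\deg_G(v_3)=\deg_G(v_5)=\deg_G(w)=2$, and $\deg_G(v_4)\ge 3$, $\deg_G(u)\ge 3$, $\deg_G(x)\ge 3$. (b) Twelve distinct vertices $v_1,\dots,v_6,w_1,w_2,w_3,u_1,u_2,u_3$ such that the edges of $G$ among them are exactly $v_1v_2,v_2v_3,v_3v_4,v_4v_5,v_5v_6,v_6v_1$ and $v_jw_j,\ w_ju_j$ for $j\in\{1,2,3\}$, with $\deg_G(v_1)=\deg_G(v_2)=\deg_G(v_3)=3$, $\deg_G(v_4)=\deg_G(v_6)=\deg_G(w_1)=\deg_G(w_2)=\deg_G(w_3)=2$, and $\deg_G(v_5),\deg_G(u_1),\deg_G(u_2),\deg_G(u_3)\ge 3$.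
   Context: A 3-dynamic coloring of a graph $G$ is a proper vertex coloring such that every vertex $v$ sees at least $\min\{3,\deg_G(v)\}$ distinct colors in $N_G(v)$. $ch_3^d(G)$ is the least $k$ such that for every list assignment $L$ with $|L(v)|\ge k$ for all $v$, $G$ has a 3-dynamic coloring $\phi$ with $\phi(v)\in L(v)$ for all $v$. -}

module Defs where

open import Data.Nat using (ℕ; _≤_; _<ᵇ_; _≡ᵇ_; _⊓_; _+_)
open import Data.Nat.Properties using (_≟_)
open import Data.Bool using (Bool; true; false; _∧_; _∨_)
open import Data.Fin using (Fin; toℕ; #_)
open import Data.List using (List; []; _∷_; length; filterᵇ; map; deduplicate; allFin; concatMap)
open import Data.Bool.ListAction using (any)
open import Data.List.Membership.Propositional using (_∈_)
open import Data.List.Relation.Unary.Unique.Propositional using (Unique)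
open import Data.Product using (Σ; _×_; _,_; ∃)
open import Relation.Binary.PropositionalEquality using (_≡_; _≢_)
open import Relation.Nullary using (¬_)
open import Function.Definitions using (Injective)

record Graph (n : ℕ) : Set where
  field
    adj    : Fin n → Fin n → Bool
    sym    : ∀ u v → adj u v ≡ adj v u
    irrefl : ∀ v → adj v v ≡ false
open Graph public

nbrs : ∀ {n} → Graph n → Fin n → List (Fin n)
nbrs {n} G v = filterᵇ (adj G v) (allFin n)
deg : ∀ {n} → Graph n → Fin n → ℕ
deg G v = length (nbrs G v)

edgeCount : ∀ {n} → Graph n → ℕ
edgeCount {n} G =
  length (concatMap (λ u → filterᵇ (λ v → (toℕ u <ᵇ toℕ v) ∧ adj G u v) (allFin n)) (allFin n))

Proper : ∀ {n} → Graph n → (Fin n → ℕ) → Set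
Proper G φ = ∀ u v → adj G u v ≡ true → φ u ≢ φ v

seenColours : ∀ {n} → Graph n → (Fin n → ℕ) → Fin n → ℕ
seenColours G φ v = length (deduplicate _≟_ (map φ (nbrs G v)))

Dynamic3 : ∀ {n} → Graph n → (Fin n → ℕ) → Set
Dynamic3 G φ = Proper G φ × (∀ v → 3 ⊓ deg G v ≤ seenColours G φ v)

ListAssignment : ℕ → ℕ → Set
ListAssignment n k = Σ (Fin n → List ℕ) λ L → ∀ v → Unique (L v) × k ≤ length (L v)

Choosable3d : ∀ {n} → Graph n → ℕ → Set
Choosable3d {n} G k = (LA : ListAssignment n k) →
  ∃ λ (φ : Fin n → ℕ) → Dynamic3 G φ × (∀ v → φ v ∈ Data.Product.proj₁ LA v)

ChGreater : ∀ {n} → Graph n → ℕ → Set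
ChGreater G k = ¬ Choosable3d G k

MinimalCounterexample : ∀ {n} → Graph n → ℕ → Set
MinimalCounterexample {n} G k =
  ChGreater G k ×
  (∀ m (H : Graph m) → ChGreater H k → n + edgeCount G ≤ m + edgeCount H)

edgeListAdj : ∀ {N} → List (ℕ × ℕ) → Fin N → Fin N → Bool
edgeListAdj es a b = any (λ { (i , j) →
  ((i ≡ᵇ toℕ a) ∧ (j ≡ᵇ toℕ b)) ∨ ((i ≡ᵇ toℕ b) ∧ (j ≡ᵇ toℕ a)) }) es

InducedCopy : ∀ {n} N → Graph n → List (ℕ × ℕ) → (Fin N → Fin n) → Set
InducedCopy N G es f = Injective _≡_ _≡_ f × (∀ a b → adj G (f a) (f b) ≡ edgeListAdj es a b)

-- Configuration (a): labels 0=v1 1=v2 2=v3 3=v4 4=v5 5=w 6=u 7=x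
edgesA : List (ℕ × ℕ)
edgesA = (0 , 1) ∷ (1 , 2) ∷ (2 , 3) ∷ (3 , 4) ∷ (4 , 0) ∷ (0 , 5) ∷ (5 , 6) ∷ (1 , 7) ∷ []

ConfigA : ∀ {n} → Graph n → Set
ConfigA {n} G = ∃ λ (f : Fin 8 → Fin n) → InducedCopy 8 G edgesA f ×
  (deg G (f (# 0)) ≡ 3) × (deg G (f (# 1)) ≡ 3) ×
  (deg G (f (# 2)) ≡ 2) × (deg G (f (# 4)) ≡ 2) × (deg G (f (# 5)) ≡ 2) ×
  (3 ≤ deg G (f (# 3))) × (3 ≤ deg G (f (# 6))) × (3 ≤ deg G (f (# 7)))

-- Configuration (b): labels 0..5 = v1..v6, 6,7,8 = w1,w2,w3, 9,10,11 = u1,u2,u3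
edgesB : List (ℕ × ℕ)
edgesB = (0 , 1) ∷ (1 , 2) ∷ (2 , 3) ∷ (3 , 4) ∷ (4 , 5) ∷ (5 , 0) ∷
         (0 , 6) ∷ (6 , 9) ∷ (1 , 7) ∷ (7 , 10) ∷ (2 , 8) ∷ (8 , 11) ∷ []

ConfigB : ∀ {n} → Graph n → Set
ConfigB {n} G = ∃ λ (f : Fin 12 → Fin n) → InducedCopy 12 G edgesB f ×
  (deg G (f (# 0)) ≡ 3) × (deg G (f (# 1)) ≡ 3) × (deg G (f (# 2)) ≡ 3) ×
  (deg G (f (# 3)) ≡ 2) × (deg G (f (# 5)) ≡ 2) ×
  (deg G (f (# 6)) ≡ 2) × (deg G (f (# 7)) ≡ 2) × (deg G (f (# 8)) ≡ 2) ×
  (3 ≤ deg G (f (# 4))) × (3 ≤ deg G (f (# 9))) ×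
  (3 ≤ deg G (f (# 10))) × (3 ≤ deg G (f (# 11)))

-- Let S be the vertices of the configuration whose degree is prescribed exactly. Deleting
-- all edges at S leaves a graph H on the same vertices with fewer edges, so by minimality H
-- has a 3-dynamic colouring φ from the lists. Keep φ off S and recolour S: every neighbour
-- of a vertex of S lies in the configuration, and a remaining vertex b of degree at least 3
-- still has 3 − |N(b) ∩ S| neighbours in H with distinct φ-colours, because φ is 3-dynamic
-- there. It therefore suffices to pick colours for S from lists of six making every closed
-- neighbourhood of a vertex of S, and N(b) ∩ S together with those colours, rainbow. This is
-- a greedy choice, with one saving from a non-adjacent pair of S without common neighbours
-- (v₃, w in (a); v₁, v₄ in (b)): either they share a colour, or the impossibility of doing
-- so provides an inequality that need not be enforced.

module Submission where

open import Defs hiding (sym)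
open import Data.Nat using (ℕ; suc; _≤_; _<_; _⊓_; _+_; z≤n; s≤s; _<ᵇ_)
import Data.Nat.Properties as ℕₚ
open import Data.Bool using (Bool; true; false; _∧_; _∨_; not; if_then_else_; T)
open import Data.Bool.Properties using (T?; T-≡; ∨-comm; ∧-zeroʳ; ∧-conical; ¬-not) renaming (_≟_ to _≟ᵇ_)
open import Data.Fin using (Fin; toℕ; #_)
open import Data.Vec as Vec using ([]; _∷_)
import Data.Fin.Properties as Finₚ
open import Data.List using (List; []; _∷_; length; filterᵇ; map; deduplicate; allFin; concatMap; _++_)
open import Data.List.Properties
  using (length-++; length-map; length-removeAt′; map-∘; map-cong; map-cong-local; map-++; filter-≐)
open import Data.List.Membership.Propositional using (_∈_; find; lose)
open import Data.List.Membership.Propositional.Properties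
  using ( ∈-map⁺; ∈-map⁻; ∈-filter⁺; ∈-filter⁻; ∈-allFin; ∈-deduplicate⁺; ∈-deduplicate⁻
        ; ∈-++⁺ˡ; ∈-++⁺ʳ)
import Data.List.Membership.DecPropositional as DecMembership
open DecMembership ℕₚ._≟_ using () renaming (_∈?_ to _∈ℕ?_)
open import Data.List.Relation.Binary.Subset.Propositional using (_⊆_)
open import Data.List.Relation.Unary.Any as Any using (here; there; _─_; index)
open import Data.List.Relation.Unary.All as All using (All; []; _∷_)
import Data.List.Relation.Unary.All.Properties as Allₚ
open import Data.List.Relation.Unary.AllPairs using ([]; _∷_)
open import Data.List.Relation.Unary.Unique.Propositional using (Unique)
import Data.List.Relation.Unary.Unique.Propositional.Properties as Unique
open import Data.List.Relation.Unary.Unique.DecPropositional.Properties using (deduplicate-!)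
open import Data.Product using (Σ; _×_; _,_; proj₁; proj₂; ∃; ∃₂)
open import Data.Sum using (_⊎_; inj₁; inj₂)
open import Function using (_∘_)
open import Function.Bundles using (Equivalence)
open import Relation.Binary.Definitions using (DecidableEquality; tri<; tri≈; tri>)
open import Relation.Binary.PropositionalEquality
open import Relation.Nullary using (¬_; Dec; yes; no; ¬?; contradiction)
open import Relation.Nullary.Decidable using (decidable-stable; True; toWitness; _×-dec_)

module _ {A : Set} where

  ∈-─⁺ : ∀ {x y} {xs : List A} (x∈xs : x ∈ xs) → y ∈ xs → y ≢ x → y ∈ (xs ─ x∈xs)
  ∈-─⁺ (here refl)  (here refl)  y≢x = contradiction refl y≢x
  ∈-─⁺ (here refl)  (there y∈xs) _   = y∈xs
  ∈-─⁺ (there _)    (here refl)  _   = here refl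
  ∈-─⁺ (there x∈xs) (there y∈xs) y≢x = there (∈-─⁺ x∈xs y∈xs y≢x)

  unique-⊆⇒length≤ : ∀ {xs ys : List A} → Unique xs → xs ⊆ ys → length xs ≤ length ys
  unique-⊆⇒length≤ {[]}     _             _  = z≤n
  unique-⊆⇒length≤ {x ∷ xs} {ys} (x∉xs ∷ !xs) xs⊆ys = begin
    suc (length xs)          ≤⟨ s≤s (unique-⊆⇒length≤ !xs xs⊆ys─x) ⟩
    suc (length (ys ─ x∈ys)) ≡⟨ length-removeAt′ ys (index x∈ys) ⟨
    length ys                ∎
    where
    open ℕₚ.≤-Reasoning
    x∈ys : x ∈ ys
    x∈ys = xs⊆ys (here refl)
    xs⊆ys─x : xs ⊆ (ys ─ x∈ys)
    xs⊆ys─x y∈xs = ∈-─⁺ x∈ys (xs⊆ys (there y∈xs)) λ { refl → All.lookup x∉xs y∈xs refl }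

  ∈-filterᵇ⁺ : ∀ (p : A → Bool) {x xs} → x ∈ xs → p x ≡ true → x ∈ filterᵇ p xs
  ∈-filterᵇ⁺ p x∈xs px = ∈-filter⁺ (T? ∘ p) x∈xs (Equivalence.from T-≡ px)

  ∈-filterᵇ⁻ : ∀ (p : A → Bool) {x} xs → x ∈ filterᵇ p xs → p x ≡ true
  ∈-filterᵇ⁻ p xs x∈ = Equivalence.to T-≡ (proj₂ (∈-filter⁻ (T? ∘ p) {xs = xs} x∈))

  1≤length⇒∃∈ : ∀ {xs : List A} → 1 ≤ length xs → ∃ λ x → x ∈ xs
  1≤length⇒∃∈ {x ∷ _} _ = x , here refl

  two-members : ∀ {xs : List A} → Unique xs → 2 ≤ length xs → ∃₂ λ a b → a ∈ xs × b ∈ xs × a ≢ b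
  two-members {a ∷ b ∷ _} ((a≢b ∷ _) ∷ _) _         = a , b , here refl , there (here refl) , a≢b
  two-members {_ ∷ []}    _                 (s≤s ())

  module _ (_≟_ : DecidableEquality A) where
    open DecMembership _≟_ using (_∈?_)

    choose : ∀ F {L} → Unique L → length F < length L → ∃ λ c → c ∈ L × All (c ≢_) F
    choose F {L} !L F<L with Any.any? (λ c → ¬? (c ∈? F)) L
    ... | yes ∃c∉F = let c , c∈L , c∉F = find ∃c∉F in c , c∈L , Allₚ.¬Any⇒All¬ F c∉F
    ... | no ¬∃c∉F = contradiction (unique-⊆⇒length≤ !L L⊆F) (ℕₚ.<⇒≱ F<L)
      where
      L⊆F : L ⊆ F
      L⊆F c∈L = decidable-stable (_ ∈? F) (¬∃c∉F ∘ lose c∈L)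

  module _ (p q : A → Bool) (p⇒q : ∀ x → p x ≡ true → q x ≡ true) where

    length-filterᵇ-≤ : ∀ xs → length (filterᵇ p xs) ≤ length (filterᵇ q xs)
    length-filterᵇ-≤ [] = z≤n
    length-filterᵇ-≤ (x ∷ xs) with p x in px | q x in qx
    ... | true  | true  = s≤s (length-filterᵇ-≤ xs)
    ... | true  | false = contradiction (trans (sym qx) (p⇒q x px)) λ ()
    ... | false | true  = ℕₚ.m≤n⇒m≤1+n (length-filterᵇ-≤ xs)
    ... | false | false = length-filterᵇ-≤ xs

    length-filterᵇ-< : ∀ {y} xs → y ∈ xs → p y ≡ false → q y ≡ true →
                       length (filterᵇ p xs) < length (filterᵇ q xs)
    length-filterᵇ-< (x ∷ xs) (here refl) py qy rewrite py | qy = s≤s (length-filterᵇ-≤ xs)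
    length-filterᵇ-< (x ∷ xs) (there y∈xs) py qy with p x in px | q x in qx
    ... | true  | true  = s≤s (length-filterᵇ-< xs y∈xs py qy)
    ... | true  | false = contradiction (trans (sym qx) (p⇒q x px)) λ ()
    ... | false | true  = ℕₚ.m≤n⇒m≤1+n (length-filterᵇ-< xs y∈xs py qy)
    ... | false | false = length-filterᵇ-< xs y∈xs py qy

module _ {A B : Set} (g h : A → List B) (g≤h : ∀ x → length (g x) ≤ length (h x)) where

  length-concatMap-≤ : ∀ xs → length (concatMap g xs) ≤ length (concatMap h xs)
  length-concatMap-≤ [] = z≤n
  length-concatMap-≤ (x ∷ xs)
    rewrite length-++ (g x) {concatMap g xs} | length-++ (h x) {concatMap h xs}
    = ℕₚ.+-mono-≤ (g≤h x) (length-concatMap-≤ xs)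

  length-concatMap-< : ∀ {y} xs → y ∈ xs → length (g y) < length (h y) →
                       length (concatMap g xs) < length (concatMap h xs)
  length-concatMap-< (x ∷ xs) y∈xs gy<hy
    rewrite length-++ (g x) {concatMap g xs} | length-++ (h x) {concatMap h xs}
    with y∈xs
  ... | here refl    = ℕₚ.+-mono-<-≤ gy<hy (length-concatMap-≤ xs)
  ... | there y∈xs′  = ℕₚ.+-mono-≤-< (g≤h x) (length-concatMap-< xs y∈xs′ gy<hy)

-- Neighbourhoods and seen colours

module _ {n : ℕ} (G : Graph n) where

  ∈-nbrs⁺ : ∀ {v w} → adj G v w ≡ true → w ∈ nbrs G v
  ∈-nbrs⁺ {v} {w} = ∈-filterᵇ⁺ (adj G v) (∈-allFin w)

  ∈-nbrs⁻ : ∀ {v w} → w ∈ nbrs G v → adj G v w ≡ true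
  ∈-nbrs⁻ {v} = ∈-filterᵇ⁻ (adj G v) (allFin n)

  nbrs-unique : ∀ v → Unique (nbrs G v)
  nbrs-unique v = Unique.filter⁺ (T? ∘ adj G v) (Unique.allFin⁺ n)

  length≤seenColours : ∀ ψ v xs → All (λ w → adj G v w ≡ true) xs → Unique (map ψ xs) →
                       length xs ≤ seenColours G ψ v
  length≤seenColours ψ v xs adjs !ψxs = subst (_≤ _) (length-map ψ xs) (unique-⊆⇒length≤ !ψxs seen)
    where
    seen : map ψ xs ⊆ deduplicate ℕₚ._≟_ (map ψ (nbrs G v))
    seen a∈ψxs with ∈-map⁻ ψ a∈ψxs
    ... | w , w∈xs , refl = ∈-deduplicate⁺ ℕₚ._≟_ (∈-map⁺ ψ (∈-nbrs⁺ (All.lookup adjs w∈xs)))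

  nbr∈full-nbr-list : ∀ v xs → Unique xs → All (λ w → adj G v w ≡ true) xs → deg G v ≤ length xs →
                      ∀ {y} → adj G v y ≡ true → y ∈ xs
  nbr∈full-nbr-list v xs !xs adjs deg≤ {y} vy with DecMembership._∈?_ Finₚ._≟_ y xs
  ... | yes y∈xs = y∈xs
  ... | no  y∉xs = contradiction (ℕₚ.≤-trans longer deg≤) (ℕₚ.<-irrefl refl)
    where
    longer : suc (length xs) ≤ deg G v
    longer = unique-⊆⇒length≤ (Allₚ.¬Any⇒All¬ xs y∉xs ∷ !xs)
      λ { (here refl) → ∈-nbrs⁺ vy ; (there w∈xs) → ∈-nbrs⁺ (All.lookup adjs w∈xs) }

  two-distinct-colours : ∀ φ v → 2 ≤ seenColours G φ v →
                         ∃₂ λ p q → adj G v p ≡ true × adj G v q ≡ true × φ p ≢ φ q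
  two-distinct-colours φ v 2≤seen
    with a , b , a∈ , b∈ , a≢b ← two-members (deduplicate-! ℕₚ._≟_ (map φ (nbrs G v))) 2≤seen
    with p , p∈N , refl ← ∈-map⁻ φ (∈-deduplicate⁻ ℕₚ._≟_ _ a∈)
    with q , q∈N , refl ← ∈-map⁻ φ (∈-deduplicate⁻ ℕₚ._≟_ _ b∈)
    = p , q , ∈-nbrs⁻ p∈N , ∈-nbrs⁻ q∈N , a≢b

-- Deleting all edges at a set of vertices

module DeleteEdgesAt {n : ℕ} (G : Graph n) (S : Fin n → Bool) where

  H : Graph n
  H = record
    { adj    = λ u v → adj G u v ∧ not (S u ∨ S v)
    ; sym    = λ u v → cong₂ _∧_ (Graph.sym G u v) (cong not (∨-comm (S u) (S v)))
    ; irrefl = λ v → cong (_∧ not (S v ∨ S v)) (Graph.irrefl G v)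
    }

  adjH⁻ : ∀ {v w} → adj H v w ≡ true → adj G v w ≡ true × S w ≡ false
  adjH⁻ {v} {w} vw with adj G v w | S v | S w
  adjH⁻ ()  | false | _     | _
  adjH⁻ ()  | true  | true  | _
  adjH⁻ ()  | true  | false | true
  adjH⁻ _   | true  | false | false = refl , refl

  adjH⁺ : ∀ {v w} → adj G v w ≡ true → S v ≡ false → S w ≡ false → adj H v w ≡ true
  adjH⁺ vw v∉S w∉S rewrite vw | v∉S | w∉S = refl

  adjH-at-S : ∀ {v w} → S v ≡ true → adj H v w ≡ false
  adjH-at-S {v} {w} v∈S rewrite v∈S = ∧-zeroʳ (adj G v w)

  private
    edge-row : Graph n → Fin n → Fin n → Bool
    edge-row K u v = (toℕ u <ᵇ toℕ v) ∧ adj K u v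

    row-H⇒G : ∀ u v → edge-row H u v ≡ true → edge-row G u v ≡ true
    row-H⇒G u v e with toℕ u <ᵇ toℕ v | adj G u v
    ... | true  | true  = refl
    ... | true  | false = e
    ... | false | _     = e

    edgeCount-H<-ordered : ∀ {u v} → toℕ u < toℕ v → adj G u v ≡ true → adj H u v ≡ false →
                           edgeCount H < edgeCount G
    edgeCount-H<-ordered {u} {v} u<v uvG uvH =
      length-concatMap-< (row H) (row G)
        (λ a → length-filterᵇ-≤ (edge-row H a) (edge-row G a) (row-H⇒G a) (allFin n))
        (allFin n) (∈-allFin u)
        (length-filterᵇ-< (edge-row H u) (edge-row G u) (row-H⇒G u) (allFin n) (∈-allFin v) rowH rowG)
      where
      row : Graph n → Fin n → List (Fin n)
      row K a = filterᵇ (edge-row K a) (allFin n)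
      u<ᵇv : (toℕ u <ᵇ toℕ v) ≡ true
      u<ᵇv = Equivalence.to T-≡ (ℕₚ.<⇒<ᵇ u<v)
      rowH : edge-row H u v ≡ false
      rowH rewrite u<ᵇv | uvH = refl
      rowG : edge-row G u v ≡ true
      rowG rewrite u<ᵇv | uvG = refl

  edgeCount-H< : ∀ {u v} → adj G u v ≡ true → S u ≡ true → edgeCount H < edgeCount G
  edgeCount-H< {u} {v} uv u∈S with ℕₚ.<-cmp (toℕ u) (toℕ v)
  ... | tri< u<v _ _ = edgeCount-H<-ordered u<v uv (adjH-at-S u∈S)
  ... | tri> _ _ v<u = edgeCount-H<-ordered v<u (trans (Graph.sym G v u) uv)
                         (trans (Graph.sym H v u) (adjH-at-S u∈S))
  ... | tri≈ _ u≡v _ with Finₚ.toℕ-injective u≡v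
  ...   | refl = contradiction (trans (sym (Graph.irrefl G u)) uv) λ ()

  nbrs-away-from-S : ∀ {v} → S v ≡ false → (∀ {w} → adj G v w ≡ true → S w ≡ false) →
                     nbrs G v ≡ nbrs H v
  nbrs-away-from-S {v} v∉S far = filter-≐ (T? ∘ adj G v) (T? ∘ adj H v)
    ((λ {w} → subst T (same-adj w)) , (λ {w} → subst T (sym (same-adj w)))) (allFin n)
    where
    same-adj : ∀ w → adj G v w ≡ adj H v w
    same-adj w with adj G v w in vw
    ... | true  rewrite v∉S | far vw = refl
    ... | false = refl

  Near : Fin n → Set
  Near v = S v ≡ true ⊎ ∃ λ w → adj G v w ≡ true × S w ≡ true

  module _ {φ ψ : Fin n → ℕ} (φ-dynamic : Dynamic3 H φ) (ψ≡φ : ∀ v → S v ≡ false → ψ v ≡ φ v) where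

    dynamic3-extension : (∀ u v → adj G u v ≡ true → S u ≡ true → ψ u ≢ ψ v) →
                         (∀ v → Near v → 3 ⊓ deg G v ≤ seenColours G ψ v) → Dynamic3 G ψ
    dynamic3-extension proper-at-S dynamic-near-S = proper , dynamic
      where
      proper : Proper G ψ
      proper u v uv with S u in Su | S v in Sv
      ... | true  | _     = proper-at-S u v uv Su
      ... | false | true  = ≢-sym (proper-at-S v u (trans (Graph.sym G v u) uv) Sv)
      ... | false | false rewrite ψ≡φ u Su | ψ≡φ v Sv = proj₁ φ-dynamic u v (adjH⁺ uv Su Sv)

      dynamic : ∀ v → 3 ⊓ deg G v ≤ seenColours G ψ v
      dynamic v with S v in Sv
      ... | true = dynamic-near-S v (inj₁ Sv)
      ... | false with Finₚ.any? (λ w → adj G v w ∧ S w ≟ᵇ true)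
      ...   | yes (w , vw∧w∈S) =
                dynamic-near-S v (inj₂ (w , proj₁ ∧-conical _ _ vw∧w∈S , proj₂ ∧-conical _ _ vw∧w∈S))
      ...   | no ∄w = subst₂ (λ N s → 3 ⊓ length N ≤ s) (sym same-nbrs) (sym same-colours) (proj₂ φ-dynamic v)
        where
        far : ∀ {w} → adj G v w ≡ true → S w ≡ false
        far {w} vw = ¬-not λ w∈S → ∄w (w , cong₂ _∧_ vw w∈S)
        same-nbrs : nbrs G v ≡ nbrs H v
        same-nbrs = nbrs-away-from-S Sv far
        same-colours : seenColours G ψ v ≡ seenColours H φ v
        same-colours = cong (length ∘ deduplicate ℕₚ._≟_) (begin
          map ψ (nbrs G v) ≡⟨ map-cong-local (All.tabulate (λ w∈N → ψ≡φ _ (far (∈-nbrs⁻ G w∈N)))) ⟩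
          map φ (nbrs G v) ≡⟨ cong (map φ) same-nbrs ⟩
          map φ (nbrs H v) ∎)
          where open ≡-Reasoning

  deg≤S-nbrs+degH : ∀ {v} xs → S v ≡ false → (∀ {w} → adj G v w ≡ true → S w ≡ true → w ∈ xs) →
                    deg G v ≤ length xs + deg H v
  deg≤S-nbrs+degH {v} xs v∉S S-nbrs⊆xs = begin
    deg G v                  ≤⟨ unique-⊆⇒length≤ (nbrs-unique G v) split ⟩
    length (xs ++ nbrs H v)  ≡⟨ length-++ xs ⟩
    length xs + deg H v      ∎
    where
    open ℕₚ.≤-Reasoning
    split : nbrs G v ⊆ xs ++ nbrs H v
    split {w} w∈N with S w in Sw
    ... | true  = ∈-++⁺ˡ (S-nbrs⊆xs (∈-nbrs⁻ G w∈N) Sw)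
    ... | false = ∈-++⁺ʳ xs (∈-nbrs⁺ H (adjH⁺ (∈-nbrs⁻ G w∈N) v∉S Sw))

  module _ {v} xs (v∉S : S v ≡ false) (S-nbrs⊆xs : ∀ {w} → adj G v w ≡ true → S w ≡ true → w ∈ xs) where

    private
      degH≥ : ∀ m → m + length xs ≤ deg G v → m ≤ deg H v
      degH≥ m m+xs≤deg = ℕₚ.+-cancelˡ-≤ (length xs) m (deg H v)
        (ℕₚ.≤-trans (ℕₚ.≤-reflexive (ℕₚ.+-comm (length xs) m))
                   (ℕₚ.≤-trans m+xs≤deg (deg≤S-nbrs+degH xs v∉S S-nbrs⊆xs)))

    outside-neighbour : 1 + length xs ≤ deg G v → ∃ λ z → adj H v z ≡ true
    outside-neighbour 1+xs≤deg with z , z∈N ← 1≤length⇒∃∈ (degH≥ 1 1+xs≤deg) = z , ∈-nbrs⁻ H z∈N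

    two-coloured-outside-neighbours : ∀ {φ} → Dynamic3 H φ → 2 + length xs ≤ deg G v →
      ∃₂ λ p q → adj H v p ≡ true × adj H v q ≡ true × φ p ≢ φ q
    two-coloured-outside-neighbours {φ} φ-dynamic 2+xs≤deg = two-distinct-colours H φ v
      (ℕₚ.≤-trans (ℕₚ.⊓-glb (s≤s (s≤s z≤n)) (degH≥ 2 2+xs≤deg)) (proj₂ φ-dynamic v))

module _ {k n} (G : Graph n) (S : Fin n → Bool) (minimal : MinimalCounterexample G k) where
  open DeleteEdgesAt G S

  minimal⇒irreducible : ∀ {u v} → adj G u v ≡ true → S u ≡ true → ¬ (Choosable3d H k → Choosable3d G k)
  minimal⇒irreducible uv u∈S extend =
    ℕₚ.<⇒≱ (ℕₚ.+-monoʳ-< n (edgeCount-H< uv u∈S)) (proj₂ minimal n H (proj₁ minimal ∘ extend))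

-- Recolouring a labelled copy of a configuration

module LabelledCopy {n N : ℕ} (G : Graph n) (es : List (ℕ × ℕ)) {f : Fin N → Fin n}
                    (copy : InducedCopy N G es f) (isS : Fin N → Bool) where

  private
    f-injective : ∀ {l t} → f l ≡ f t → l ≡ t
    f-injective = proj₁ copy

    f-adj : ∀ l t → adj G (f l) (f t) ≡ edgeListAdj es l t
    f-adj = proj₂ copy

    preimage : ∀ v → Dec (∃ λ l → f l ≡ v)
    preimage v = Finₚ.any? (λ l → f l Finₚ.≟ v)

  conf-nbrs : Fin N → List (Fin N)
  conf-nbrs l = filterᵇ (edgeListAdj es l) (allFin N)

  conf-S-adj : Fin N → Fin N → Bool
  conf-S-adj l t = isS t ∧ edgeListAdj es l t

  conf-S-nbrs : Fin N → List (Fin N)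
  conf-S-nbrs l = filterᵇ (conf-S-adj l) (allFin N)

  inS : Fin n → Bool
  inS v with preimage v
  ... | yes (l , _) = isS l
  ... | no _        = false

  inS-f : ∀ l → inS (f l) ≡ isS l
  inS-f l with preimage (f l)
  ... | yes (t , ft≡fl) = cong isS (f-injective ft≡fl)
  ... | no ∄t           = contradiction (l , refl) ∄t

  inS⁻ : ∀ {v} → inS v ≡ true → ∃ λ l → isS l ≡ true × f l ≡ v
  inS⁻ {v} v∈S with preimage v
  ... | yes (l , fl≡v) = l , v∈S , fl≡v

  open DeleteEdgesAt G inS public

  OutsideNbr : Fin n → Fin n → Set
  OutsideNbr v w = adj G v w ≡ true × inS w ≡ false

  record TwoColouredOutsideNbrs (φ : Fin n → ℕ) (v : Fin n) : Set where
    field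
      p q       : Fin n
      p-outside : OutsideNbr v p
      q-outside : OutsideNbr v q
      φp≢φq     : φ p ≢ φ q

  conf-nbrs-adj : ∀ l → All (λ t → adj G (f l) (f t) ≡ true) (conf-nbrs l)
  conf-nbrs-adj l = All.tabulate λ {t} t∈ → trans (f-adj l t) (∈-filterᵇ⁻ (edgeListAdj es l) (allFin N) t∈)

  conf-S-nbrs-adj : ∀ b → All (λ t → adj G (f b) (f t) ≡ true) (conf-S-nbrs b)
  conf-S-nbrs-adj b = All.tabulate λ {t} t∈ →
    trans (f-adj b t) (proj₂ ∧-conical _ _ (∈-filterᵇ⁻ (conf-S-adj b) (allFin N) t∈))

  S-nbrs⊆conf-S-nbrs : ∀ b {w} → adj G (f b) w ≡ true → inS w ≡ true → w ∈ map f (conf-S-nbrs b)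
  S-nbrs⊆conf-S-nbrs b bw w∈S with inS⁻ w∈S
  ... | l , l∈S , refl =
    ∈-map⁺ f (∈-filterᵇ⁺ (conf-S-adj b) (∈-allFin l) (cong₂ _∧_ l∈S (trans (sym (f-adj b l)) bw)))

  module _ {b} (b∉S : isS b ≡ false) where

    private
      fb∉S : inS (f b) ≡ false
      fb∉S = trans (inS-f b) b∉S

      fewer : ∀ m → m + length (conf-S-nbrs b) ≤ deg G (f b) →
                    m + length (map f (conf-S-nbrs b)) ≤ deg G (f b)
      fewer m = subst (λ s → m + s ≤ deg G (f b)) (sym (length-map f (conf-S-nbrs b)))

    outside-nbr : 1 + length (conf-S-nbrs b) ≤ deg G (f b) → ∃ λ z → OutsideNbr (f b) z
    outside-nbr 1+S≤deg with z , bz ← outside-neighbour _ fb∉S (S-nbrs⊆conf-S-nbrs b) (fewer 1 1+S≤deg)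
      = z , adjH⁻ bz

    two-coloured-outside-nbrs : ∀ {φ} → Dynamic3 H φ → 2 + length (conf-S-nbrs b) ≤ deg G (f b) →
                                TwoColouredOutsideNbrs φ (f b)
    two-coloured-outside-nbrs φ-dynamic 2+S≤deg
      with p , q , bp , bq , φp≢φq ←
             two-coloured-outside-neighbours _ fb∉S (S-nbrs⊆conf-S-nbrs b) φ-dynamic (fewer 2 2+S≤deg)
      = record { p = p ; q = q ; p-outside = adjH⁻ bp ; q-outside = adjH⁻ bq ; φp≢φq = φp≢φq }

  module Recolour (φ : Fin n → ℕ) (c : Fin N → ℕ) where

    col : Fin N → ℕ
    col l = if isS l then c l else φ (f l)

    ψ : Fin n → ℕ
    ψ v with preimage v
    ... | yes (l , _) = col l
    ... | no _        = φ v

    ψ-f : ∀ l → ψ (f l) ≡ col l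
    ψ-f l with preimage (f l)
    ... | yes (t , ft≡fl) = cong col (f-injective ft≡fl)
    ... | no ∄t           = contradiction (l , refl) ∄t

    ψ-outside : ∀ v → inS v ≡ false → ψ v ≡ φ v
    ψ-outside v v∉S with preimage v
    ... | no _ = refl
    ... | yes (l , refl) with isS l
    ...   | false = refl
    ...   | true  = contradiction v∉S λ ()

    ψ∈L : (L : Fin n → List ℕ) → (∀ l → isS l ≡ true → c l ∈ L (f l)) → (∀ v → φ v ∈ L v) →
          ∀ v → ψ v ∈ L v
    ψ∈L L c∈L φ∈L v with preimage v
    ... | no _ = φ∈L v
    ... | yes (l , refl) with isS l in l∈S
    ...   | true  = c∈L l l∈S
    ...   | false = φ∈L (f l)

    map-ψ-f : ∀ ls → map ψ (map f ls) ≡ map col ls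
    map-ψ-f ls = trans (sym (map-∘ ls)) (map-cong ψ-f ls)

    boundary-dynamic : ∀ b ws → All (OutsideNbr (f b)) ws → Unique (map col (conf-S-nbrs b) ++ map φ ws) →
                       3 ≤ length (conf-S-nbrs b) + length ws → 3 ⊓ deg G (f b) ≤ seenColours G ψ (f b)
    boundary-dynamic b ws outside !cols 3≤ = begin
      3 ⊓ deg G (f b)                             ≤⟨ ℕₚ.m⊓n≤m 3 _ ⟩
      3                                           ≤⟨ 3≤ ⟩
      length (conf-S-nbrs b) + length ws          ≡⟨ cong (_+ length ws) (length-map f (conf-S-nbrs b)) ⟨
      length (map f (conf-S-nbrs b)) + length ws  ≡⟨ length-++ (map f (conf-S-nbrs b)) ⟨
      length (map f (conf-S-nbrs b) ++ ws)        ≤⟨ length≤seenColours G ψ (f b) _ adjs !ψ-cols ⟩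
      seenColours G ψ (f b)                       ∎
      where
      open ℕₚ.≤-Reasoning
      adjs : All (λ w → adj G (f b) w ≡ true) (map f (conf-S-nbrs b) ++ ws)
      adjs = Allₚ.++⁺ (Allₚ.map⁺ (conf-S-nbrs-adj b)) (All.map proj₁ outside)
      cols-eq : map col (conf-S-nbrs b) ++ map φ ws ≡ map ψ (map f (conf-S-nbrs b) ++ ws)
      cols-eq = sym (trans (map-++ ψ (map f (conf-S-nbrs b)) ws)
                          (cong₂ _++_ (map-ψ-f (conf-S-nbrs b))
                                      (map-cong-local (All.map (λ { (_ , w∉S) → ψ-outside _ w∉S }) outside))))
      !ψ-cols : Unique (map ψ (map f (conf-S-nbrs b) ++ ws))
      !ψ-cols = subst Unique cols-eq !cols

    module _ (closed : ∀ l → isS l ≡ true → deg G (f l) ≡ length (conf-nbrs l)) where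

      labelled-nbr : ∀ {l v} → isS l ≡ true → adj G (f l) v ≡ true → ∃ λ t → t ∈ conf-nbrs l × v ≡ f t
      labelled-nbr {l} l∈S = ∈-map⁻ f ∘ nbr∈full-nbr-list G (f l) (map f (conf-nbrs l))
        (Unique.map⁺ f-injective (Unique.filter⁺ (T? ∘ edgeListAdj es l) (Unique.allFin⁺ N)))
        (Allₚ.map⁺ (conf-nbrs-adj l))
        (ℕₚ.≤-reflexive (trans (closed l l∈S) (sym (length-map f (conf-nbrs l)))))

      S-dynamic : ∀ l → isS l ≡ true → Unique (map col (conf-nbrs l)) →
                  3 ⊓ deg G (f l) ≤ seenColours G ψ (f l)
      S-dynamic l l∈S !cols = begin
        3 ⊓ deg G (f l)               ≤⟨ ℕₚ.m⊓n≤n 3 _ ⟩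
        deg G (f l)                   ≡⟨ trans (closed l l∈S) (sym (length-map f (conf-nbrs l))) ⟩
        length (map f (conf-nbrs l))  ≤⟨ length≤seenColours G ψ (f l) _ (Allₚ.map⁺ (conf-nbrs-adj l))
                                           (subst Unique (sym (map-ψ-f (conf-nbrs l))) !cols) ⟩
        seenColours G ψ (f l)         ∎
        where open ℕₚ.≤-Reasoning

      recolour-dynamic : Dynamic3 H φ →
        (∀ l → isS l ≡ true → Unique (map col (l ∷ conf-nbrs l))) →
        (∀ l → isS l ≡ false → 3 ⊓ deg G (f l) ≤ seenColours G ψ (f l)) →
        Dynamic3 G ψ
      recolour-dynamic φ-dynamic rainbow boundary = dynamic3-extension φ-dynamic ψ-outside proper-at-S near-S
        where
        label-dynamic : ∀ t → 3 ⊓ deg G (f t) ≤ seenColours G ψ (f t)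
        label-dynamic t with isS t in t∈S
        ... | true  with _ ∷ !cols ← rainbow t t∈S = S-dynamic t t∈S !cols
        ... | false = boundary t t∈S

        proper-at-S : ∀ u v → adj G u v ≡ true → inS u ≡ true → ψ u ≢ ψ v
        proper-at-S u v uv u∈S
          with l , l∈S , refl ← inS⁻ u∈S
          with t , t∈ , refl ← labelled-nbr l∈S uv
          with fresh ∷ _ ← rainbow l l∈S
          = λ ψl≡ψt → All.lookup fresh (∈-map⁺ col t∈) (trans (sym (ψ-f l)) (trans ψl≡ψt (ψ-f t)))

        near-S : ∀ v → Near v → 3 ⊓ deg G v ≤ seenColours G ψ v
        near-S v (inj₁ v∈S) with l , _ , refl ← inS⁻ v∈S = label-dynamic l
        near-S v (inj₂ (w , vw , w∈S))
          with l , l∈S , refl ← inS⁻ w∈S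
          with t , _ , refl ← labelled-nbr l∈S (trans (Graph.sym G (f l) v) vw)
          = label-dynamic t

-- Choosing colours from lists of six

SixColours : List ℕ → Set
SixColours L = Unique L × 6 ≤ length L

pick : ∀ F {L} → SixColours L → {F≤5 : True (length F ℕₚ.≤? 5)} → ∃ λ c → c ∈ L × All (c ≢_) F
pick F (!L , 6≤L) {F≤5} = choose ℕₚ._≟_ F !L (ℕₚ.≤-trans (s≤s (toWitness F≤5)) 6≤L)

avoids? : ∀ c F → Dec (All (c ≢_) F)
avoids? c = All.all? (λ y → ¬? (c ℕₚ.≟ y))

distinct₂ : ∀ {a b : ℕ} → a ≢ b → Unique (a ∷ b ∷ [])
distinct₂ a≢b = (a≢b ∷ []) ∷ [] ∷ []

distinct₃ : ∀ {a b c : ℕ} → a ≢ b → a ≢ c → b ≢ c → Unique (a ∷ b ∷ c ∷ [])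
distinct₃ a≢b a≢c b≢c = (a≢b ∷ a≢c ∷ []) ∷ distinct₂ b≢c

distinct₄ : ∀ {a b c d : ℕ} → a ≢ b → a ≢ c → a ≢ d → b ≢ c → b ≢ d → c ≢ d →
            Unique (a ∷ b ∷ c ∷ d ∷ [])
distinct₄ a≢b a≢c a≢d b≢c b≢d c≢d = (a≢b ∷ a≢c ∷ a≢d ∷ []) ∷ distinct₃ b≢c b≢d c≢d

-- Configuration (a)

-- Lists and chosen colours are named after their vertices; v₄ u x are the colours φ keeps
-- there, z that of an outside neighbour of v₄, and u₁ u₂ (x₁ x₂) those of two
-- differently coloured outside neighbours of u (of x).
record LocalColouringA (L₁ L₂ L₃ L₅ Lʷ : List ℕ) (v₄ u x z u₁ u₂ x₁ x₂ : ℕ) : Set where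
  field
    v₁ v₂ v₃ v₅ w : ℕ
    v₁∈L₁ : v₁ ∈ L₁
    v₂∈L₂ : v₂ ∈ L₂
    v₃∈L₃ : v₃ ∈ L₃
    v₅∈L₅ : v₅ ∈ L₅
    w∈Lʷ  : w ∈ Lʷ
    at-v₁ : Unique (v₁ ∷ v₂ ∷ v₅ ∷ w ∷ [])
    at-v₂ : Unique (v₂ ∷ v₁ ∷ v₃ ∷ x ∷ [])
    at-v₃ : Unique (v₃ ∷ v₂ ∷ v₄ ∷ [])
    at-v₄ : Unique (v₃ ∷ v₅ ∷ z ∷ [])
    at-v₅ : Unique (v₅ ∷ v₁ ∷ v₄ ∷ [])
    at-w  : Unique (w ∷ v₁ ∷ u ∷ [])
    at-u  : All (w ≢_) (u₁ ∷ u₂ ∷ [])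
    at-x  : All (v₂ ≢_) (x₁ ∷ x₂ ∷ [])

module _ {L₁ L₂ L₃ L₅ Lʷ : List ℕ} (v₄ u x z u₁ u₂ x₁ x₂ : ℕ) where

  private
    FitsV₃AndW : ℕ → Set
    FitsV₃AndW γ = All (γ ≢_) (v₄ ∷ z ∷ x ∷ []) × γ ∈ Lʷ × All (γ ≢_) (u ∷ u₁ ∷ u₂ ∷ [])

    fits-v₃-and-w? : ∀ γ → Dec (FitsV₃AndW γ)
    fits-v₃-and-w? γ = avoids? γ _ ×-dec (γ ∈ℕ? Lʷ ×-dec avoids? γ _)

  localColouringA : SixColours L₁ → SixColours L₂ → SixColours L₃ → SixColours L₅ → SixColours Lʷ →
           LocalColouringA L₁ L₂ L₃ L₅ Lʷ v₄ u x z u₁ u₂ x₁ x₂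
  localColouringA S₁ S₂ S₃ S₅ Sʷ with Any.any? fits-v₃-and-w? L₃
  ... | yes ∃γ
    with γ , γ∈L₃ , (γ≢v₄ ∷ γ≢z ∷ γ≢x ∷ []) , γ∈Lʷ , (γ≢u ∷ γ≢u₁ ∷ γ≢u₂ ∷ []) ← find ∃γ
    with v₂ , v₂∈L₂ , (v₂≢x ∷ v₂≢v₄ ∷ v₂≢x₁ ∷ v₂≢x₂ ∷ v₂≢γ ∷ []) ← pick (x ∷ v₄ ∷ x₁ ∷ x₂ ∷ γ ∷ []) S₂
    with v₁ , v₁∈L₁ , (v₁≢v₄ ∷ v₁≢u ∷ v₁≢x ∷ v₁≢γ ∷ v₁≢v₂ ∷ []) ← pick (v₄ ∷ u ∷ x ∷ γ ∷ v₂ ∷ []) S₁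
    with v₅ , v₅∈L₅ , (v₅≢v₄ ∷ v₅≢z ∷ v₅≢γ ∷ v₅≢v₂ ∷ v₅≢v₁ ∷ []) ← pick (v₄ ∷ z ∷ γ ∷ v₂ ∷ v₁ ∷ []) S₅
    = record
      { v₁ = v₁ ; v₂ = v₂ ; v₃ = γ ; v₅ = v₅ ; w = γ
      ; v₁∈L₁ = v₁∈L₁ ; v₂∈L₂ = v₂∈L₂ ; v₃∈L₃ = γ∈L₃ ; v₅∈L₅ = v₅∈L₅ ; w∈Lʷ = γ∈Lʷ
      ; at-v₁ = distinct₄ v₁≢v₂ (≢-sym v₅≢v₁) v₁≢γ (≢-sym v₅≢v₂) v₂≢γ v₅≢γ
      ; at-v₂ = distinct₄ (≢-sym v₁≢v₂) v₂≢γ v₂≢x v₁≢γ v₁≢x γ≢x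
      ; at-v₃ = distinct₃ (≢-sym v₂≢γ) γ≢v₄ v₂≢v₄
      ; at-v₄ = distinct₃ (≢-sym v₅≢γ) γ≢z v₅≢z
      ; at-v₅ = distinct₃ v₅≢v₁ v₅≢v₄ v₁≢v₄
      ; at-w  = distinct₃ (≢-sym v₁≢γ) γ≢u v₁≢u
      ; at-u  = γ≢u₁ ∷ γ≢u₂ ∷ []
      ; at-x  = v₂≢x₁ ∷ v₂≢x₂ ∷ []
      }
  ... | no ∄γ
    with v₁ , v₁∈L₁ , (v₁≢v₄ ∷ v₁≢u ∷ v₁≢x ∷ []) ← pick (v₄ ∷ u ∷ x ∷ []) S₁
    with v₁ ∈ℕ? Lʷ ×-dec avoids? v₁ (u ∷ u₁ ∷ u₂ ∷ [])
  ... | yes (v₁∈Lʷ , v₁-fits-w)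
    with v₂ , v₂∈L₂ , (v₂≢x ∷ v₂≢v₄ ∷ v₂≢x₁ ∷ v₂≢x₂ ∷ v₂≢v₁ ∷ []) ← pick (x ∷ v₄ ∷ x₁ ∷ x₂ ∷ v₁ ∷ []) S₂
    with w , w∈Lʷ , (w≢u ∷ w≢u₁ ∷ w≢u₂ ∷ w≢v₁ ∷ w≢v₂ ∷ []) ← pick (u ∷ u₁ ∷ u₂ ∷ v₁ ∷ v₂ ∷ []) Sʷ
    with v₅ , v₅∈L₅ , (v₅≢v₄ ∷ v₅≢z ∷ v₅≢v₁ ∷ v₅≢v₂ ∷ v₅≢w ∷ []) ← pick (v₄ ∷ z ∷ v₁ ∷ v₂ ∷ w ∷ []) S₅
    with v₃ , v₃∈L₃ , (v₃≢v₄ ∷ v₃≢z ∷ v₃≢x ∷ v₃≢v₂ ∷ v₃≢v₅ ∷ []) ← pick (v₄ ∷ z ∷ x ∷ v₂ ∷ v₅ ∷ []) S₃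
    = record
      { v₁ = v₁ ; v₂ = v₂ ; v₃ = v₃ ; v₅ = v₅ ; w = w
      ; v₁∈L₁ = v₁∈L₁ ; v₂∈L₂ = v₂∈L₂ ; v₃∈L₃ = v₃∈L₃ ; v₅∈L₅ = v₅∈L₅ ; w∈Lʷ = w∈Lʷ
      ; at-v₁ = distinct₄ (≢-sym v₂≢v₁) (≢-sym v₅≢v₁) (≢-sym w≢v₁) (≢-sym v₅≢v₂) (≢-sym w≢v₂) v₅≢w
      ; at-v₂ = distinct₄ v₂≢v₁ (≢-sym v₃≢v₂) v₂≢x v₁≢v₃ v₁≢x v₃≢x
      ; at-v₃ = distinct₃ v₃≢v₂ v₃≢v₄ v₂≢v₄
      ; at-v₄ = distinct₃ v₃≢v₅ v₃≢z v₅≢z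
      ; at-v₅ = distinct₃ v₅≢v₁ v₅≢v₄ v₁≢v₄
      ; at-w  = distinct₃ w≢v₁ w≢u v₁≢u
      ; at-u  = w≢u₁ ∷ w≢u₂ ∷ []
      ; at-x  = v₂≢x₁ ∷ v₂≢x₂ ∷ []
      }
    where
    v₁≢v₃ : v₁ ≢ v₃
    v₁≢v₃ refl = ∄γ (lose v₃∈L₃ ((v₃≢v₄ ∷ v₃≢z ∷ v₃≢x ∷ []) , v₁∈Lʷ , v₁-fits-w))
  ... | no v₁-unfit-for-w
    with v₂ , v₂∈L₂ , (v₂≢x ∷ v₂≢v₄ ∷ v₂≢x₁ ∷ v₂≢x₂ ∷ v₂≢v₁ ∷ []) ← pick (x ∷ v₄ ∷ x₁ ∷ x₂ ∷ v₁ ∷ []) S₂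
    with v₃ , v₃∈L₃ , (v₃≢v₄ ∷ v₃≢z ∷ v₃≢x ∷ v₃≢v₁ ∷ v₃≢v₂ ∷ []) ← pick (v₄ ∷ z ∷ x ∷ v₁ ∷ v₂ ∷ []) S₃
    with v₅ , v₅∈L₅ , (v₅≢v₄ ∷ v₅≢z ∷ v₅≢v₁ ∷ v₅≢v₂ ∷ v₅≢v₃ ∷ []) ← pick (v₄ ∷ z ∷ v₁ ∷ v₂ ∷ v₃ ∷ []) S₅
    with w , w∈Lʷ , (w≢u ∷ w≢u₁ ∷ w≢u₂ ∷ w≢v₂ ∷ w≢v₅ ∷ []) ← pick (u ∷ u₁ ∷ u₂ ∷ v₂ ∷ v₅ ∷ []) Sʷ
    = record
      { v₁ = v₁ ; v₂ = v₂ ; v₃ = v₃ ; v₅ = v₅ ; w = w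
      ; v₁∈L₁ = v₁∈L₁ ; v₂∈L₂ = v₂∈L₂ ; v₃∈L₃ = v₃∈L₃ ; v₅∈L₅ = v₅∈L₅ ; w∈Lʷ = w∈Lʷ
      ; at-v₁ = distinct₄ (≢-sym v₂≢v₁) (≢-sym v₅≢v₁) v₁≢w (≢-sym v₅≢v₂) (≢-sym w≢v₂) (≢-sym w≢v₅)
      ; at-v₂ = distinct₄ v₂≢v₁ (≢-sym v₃≢v₂) v₂≢x (≢-sym v₃≢v₁) v₁≢x v₃≢x
      ; at-v₃ = distinct₃ v₃≢v₂ v₃≢v₄ v₂≢v₄
      ; at-v₄ = distinct₃ (≢-sym v₅≢v₃) v₃≢z v₅≢z
      ; at-v₅ = distinct₃ v₅≢v₁ v₅≢v₄ v₁≢v₄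
      ; at-w  = distinct₃ (≢-sym v₁≢w) w≢u v₁≢u
      ; at-u  = w≢u₁ ∷ w≢u₂ ∷ []
      ; at-x  = v₂≢x₁ ∷ v₂≢x₂ ∷ []
      }
    where
    v₁≢w : v₁ ≢ w
    v₁≢w refl = v₁-unfit-for-w (w∈Lʷ , w≢u ∷ w≢u₁ ∷ w≢u₂ ∷ [])

-- Configuration (b)

-- As for (a); here z is the colour of an outside neighbour of v₅, and aⱼ bⱼ those of two
-- differently coloured outside neighbours of uⱼ.
record LocalColouringB (L₁ L₂ L₃ L₄ L₆ Lw₁ Lw₂ Lw₃ : List ℕ) (v₅ u₁ u₂ u₃ z a₁ b₁ a₂ b₂ a₃ b₃ : ℕ) :
                       Set where
  field
    v₁ v₂ v₃ v₄ v₆ w₁ w₂ w₃ : ℕ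
    v₁∈L₁  : v₁ ∈ L₁
    v₂∈L₂  : v₂ ∈ L₂
    v₃∈L₃  : v₃ ∈ L₃
    v₄∈L₄  : v₄ ∈ L₄
    v₆∈L₆  : v₆ ∈ L₆
    w₁∈Lw₁ : w₁ ∈ Lw₁
    w₂∈Lw₂ : w₂ ∈ Lw₂
    w₃∈Lw₃ : w₃ ∈ Lw₃
    at-v₁ : Unique (v₁ ∷ v₂ ∷ v₆ ∷ w₁ ∷ [])
    at-v₂ : Unique (v₂ ∷ v₁ ∷ v₃ ∷ w₂ ∷ [])
    at-v₃ : Unique (v₃ ∷ v₂ ∷ v₄ ∷ w₃ ∷ [])
    at-v₄ : Unique (v₄ ∷ v₃ ∷ v₅ ∷ [])
    at-v₅ : Unique (v₄ ∷ v₆ ∷ z ∷ [])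
    at-v₆ : Unique (v₆ ∷ v₁ ∷ v₅ ∷ [])
    at-w₁ : Unique (w₁ ∷ v₁ ∷ u₁ ∷ [])
    at-w₂ : Unique (w₂ ∷ v₂ ∷ u₂ ∷ [])
    at-w₃ : Unique (w₃ ∷ v₃ ∷ u₃ ∷ [])
    at-u₁ : All (w₁ ≢_) (a₁ ∷ b₁ ∷ [])
    at-u₂ : All (w₂ ≢_) (a₂ ∷ b₂ ∷ [])
    at-u₃ : All (w₃ ≢_) (a₃ ∷ b₃ ∷ [])

module _ {L₁ L₂ L₃ L₄ L₆ Lw₁ Lw₂ Lw₃ : List ℕ} (v₅ u₁ u₂ u₃ z a₁ b₁ a₂ b₂ a₃ b₃ : ℕ) where

  private
    FitsV₁ : ℕ → Set
    FitsV₁ γ = γ ∈ L₁ × All (γ ≢_) (v₅ ∷ u₁ ∷ [])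

    fits-v₁? : ∀ γ → Dec (FitsV₁ γ)
    fits-v₁? γ = γ ∈ℕ? L₁ ×-dec avoids? γ _

    FitsV₁AndV₄ : ℕ → Set
    FitsV₁AndV₄ γ = All (γ ≢_) (v₅ ∷ u₁ ∷ []) × γ ∈ L₄ × All (γ ≢_) (v₅ ∷ z ∷ [])

    fits-v₁-and-v₄? : ∀ γ → Dec (FitsV₁AndV₄ γ)
    fits-v₁-and-v₄? γ = avoids? γ _ ×-dec (γ ∈ℕ? L₄ ×-dec avoids? γ _)

  localColouringB : SixColours L₁ → SixColours L₂ → SixColours L₃ → SixColours L₄ → SixColours L₆ →
           SixColours Lw₁ → SixColours Lw₂ → SixColours Lw₃ →
           LocalColouringB L₁ L₂ L₃ L₄ L₆ Lw₁ Lw₂ Lw₃ v₅ u₁ u₂ u₃ z a₁ b₁ a₂ b₂ a₃ b₃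
  localColouringB S₁ S₂ S₃ S₄ S₆ Sw₁ Sw₂ Sw₃ with Any.any? fits-v₁-and-v₄? L₁
  ... | yes ∃γ
    with γ , γ∈L₁ , (γ≢v₅ ∷ γ≢u₁ ∷ []) , γ∈L₄ , (γ≢v₅′ ∷ γ≢z ∷ []) ← find ∃γ
    with w₃ , w₃∈ , (w₃≢u₃ ∷ w₃≢a₃ ∷ w₃≢b₃ ∷ w₃≢γ ∷ []) ← pick (u₃ ∷ a₃ ∷ b₃ ∷ γ ∷ []) Sw₃
    with w₂ , w₂∈ , (w₂≢u₂ ∷ w₂≢a₂ ∷ w₂≢b₂ ∷ w₂≢γ ∷ []) ← pick (u₂ ∷ a₂ ∷ b₂ ∷ γ ∷ []) Sw₂
    with v₃ , v₃∈ , (v₃≢v₅ ∷ v₃≢u₃ ∷ v₃≢γ ∷ v₃≢w₃ ∷ v₃≢w₂ ∷ []) ← pick (v₅ ∷ u₃ ∷ γ ∷ w₃ ∷ w₂ ∷ []) S₃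
    with v₂ , v₂∈ , (v₂≢u₂ ∷ v₂≢γ ∷ v₂≢v₃ ∷ v₂≢w₂ ∷ v₂≢w₃ ∷ []) ← pick (u₂ ∷ γ ∷ v₃ ∷ w₂ ∷ w₃ ∷ []) S₂
    with w₁ , w₁∈ , (w₁≢u₁ ∷ w₁≢a₁ ∷ w₁≢b₁ ∷ w₁≢γ ∷ w₁≢v₂ ∷ []) ← pick (u₁ ∷ a₁ ∷ b₁ ∷ γ ∷ v₂ ∷ []) Sw₁
    with v₆ , v₆∈ , (v₆≢v₅ ∷ v₆≢z ∷ v₆≢γ ∷ v₆≢v₂ ∷ v₆≢w₁ ∷ []) ← pick (v₅ ∷ z ∷ γ ∷ v₂ ∷ w₁ ∷ []) S₆
    = record
      { v₁ = γ ; v₂ = v₂ ; v₃ = v₃ ; v₄ = γ ; v₆ = v₆ ; w₁ = w₁ ; w₂ = w₂ ; w₃ = w₃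
      ; v₁∈L₁ = γ∈L₁ ; v₂∈L₂ = v₂∈ ; v₃∈L₃ = v₃∈ ; v₄∈L₄ = γ∈L₄ ; v₆∈L₆ = v₆∈
      ; w₁∈Lw₁ = w₁∈ ; w₂∈Lw₂ = w₂∈ ; w₃∈Lw₃ = w₃∈
      ; at-v₁ = distinct₄ (≢-sym v₂≢γ) (≢-sym v₆≢γ) (≢-sym w₁≢γ) (≢-sym v₆≢v₂) (≢-sym w₁≢v₂) v₆≢w₁
      ; at-v₂ = distinct₄ v₂≢γ v₂≢v₃ v₂≢w₂ (≢-sym v₃≢γ) (≢-sym w₂≢γ) v₃≢w₂
      ; at-v₃ = distinct₄ (≢-sym v₂≢v₃) v₃≢γ v₃≢w₃ v₂≢γ v₂≢w₃ (≢-sym w₃≢γ)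
      ; at-v₄ = distinct₃ (≢-sym v₃≢γ) γ≢v₅′ v₃≢v₅
      ; at-v₅ = distinct₃ (≢-sym v₆≢γ) γ≢z v₆≢z
      ; at-v₆ = distinct₃ v₆≢γ v₆≢v₅ γ≢v₅
      ; at-w₁ = distinct₃ w₁≢γ w₁≢u₁ γ≢u₁
      ; at-w₂ = distinct₃ (≢-sym v₂≢w₂) w₂≢u₂ v₂≢u₂
      ; at-w₃ = distinct₃ (≢-sym v₃≢w₃) w₃≢u₃ v₃≢u₃
      ; at-u₁ = w₁≢a₁ ∷ w₁≢b₁ ∷ []
      ; at-u₂ = w₂≢a₂ ∷ w₂≢b₂ ∷ []
      ; at-u₃ = w₃≢a₃ ∷ w₃≢b₃ ∷ []
      }
  ... | no ∄γ
    with v₂ , v₂∈ , (v₂≢u₂ ∷ []) ← pick (u₂ ∷ []) S₂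
    with fits-v₁? v₂
  ... | yes (v₂∈L₁ , v₂-fits-v₁)
    with w₃ , w₃∈ , (w₃≢u₃ ∷ w₃≢a₃ ∷ w₃≢b₃ ∷ w₃≢v₂ ∷ []) ← pick (u₃ ∷ a₃ ∷ b₃ ∷ v₂ ∷ []) Sw₃
    with w₂ , w₂∈ , (w₂≢u₂ ∷ w₂≢a₂ ∷ w₂≢b₂ ∷ w₂≢v₂ ∷ []) ← pick (u₂ ∷ a₂ ∷ b₂ ∷ v₂ ∷ []) Sw₂
    with v₃ , v₃∈ , (v₃≢v₅ ∷ v₃≢u₃ ∷ v₃≢v₂ ∷ v₃≢w₂ ∷ v₃≢w₃ ∷ []) ← pick (v₅ ∷ u₃ ∷ v₂ ∷ w₂ ∷ w₃ ∷ []) S₃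
    with v₁ , v₁∈ , (v₁≢v₅ ∷ v₁≢u₁ ∷ v₁≢v₂ ∷ v₁≢v₃ ∷ v₁≢w₂ ∷ []) ← pick (v₅ ∷ u₁ ∷ v₂ ∷ v₃ ∷ w₂ ∷ []) S₁
    with w₁ , w₁∈ , (w₁≢u₁ ∷ w₁≢a₁ ∷ w₁≢b₁ ∷ w₁≢v₁ ∷ w₁≢v₂ ∷ []) ← pick (u₁ ∷ a₁ ∷ b₁ ∷ v₁ ∷ v₂ ∷ []) Sw₁
    with v₆ , v₆∈ , (v₆≢v₅ ∷ v₆≢z ∷ v₆≢v₁ ∷ v₆≢v₂ ∷ v₆≢w₁ ∷ []) ← pick (v₅ ∷ z ∷ v₁ ∷ v₂ ∷ w₁ ∷ []) S₆
    with v₄ , v₄∈ , (v₄≢v₅ ∷ v₄≢z ∷ v₄≢v₃ ∷ v₄≢w₃ ∷ v₄≢v₆ ∷ []) ← pick (v₅ ∷ z ∷ v₃ ∷ w₃ ∷ v₆ ∷ []) S₄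
    = record
      { v₁ = v₁ ; v₂ = v₂ ; v₃ = v₃ ; v₄ = v₄ ; v₆ = v₆ ; w₁ = w₁ ; w₂ = w₂ ; w₃ = w₃
      ; v₁∈L₁ = v₁∈ ; v₂∈L₂ = v₂∈ ; v₃∈L₃ = v₃∈ ; v₄∈L₄ = v₄∈ ; v₆∈L₆ = v₆∈
      ; w₁∈Lw₁ = w₁∈ ; w₂∈Lw₂ = w₂∈ ; w₃∈Lw₃ = w₃∈
      ; at-v₁ = distinct₄ v₁≢v₂ (≢-sym v₆≢v₁) (≢-sym w₁≢v₁) (≢-sym v₆≢v₂) (≢-sym w₁≢v₂) v₆≢w₁
      ; at-v₂ = distinct₄ (≢-sym v₁≢v₂) (≢-sym v₃≢v₂) (≢-sym w₂≢v₂) v₁≢v₃ v₁≢w₂ v₃≢w₂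
      ; at-v₃ = distinct₄ v₃≢v₂ (≢-sym v₄≢v₃) v₃≢w₃ v₂≢v₄ (≢-sym w₃≢v₂) v₄≢w₃
      ; at-v₄ = distinct₃ v₄≢v₃ v₄≢v₅ v₃≢v₅
      ; at-v₅ = distinct₃ v₄≢v₆ v₄≢z v₆≢z
      ; at-v₆ = distinct₃ v₆≢v₁ v₆≢v₅ v₁≢v₅
      ; at-w₁ = distinct₃ w₁≢v₁ w₁≢u₁ v₁≢u₁
      ; at-w₂ = distinct₃ w₂≢v₂ w₂≢u₂ v₂≢u₂
      ; at-w₃ = distinct₃ (≢-sym v₃≢w₃) w₃≢u₃ v₃≢u₃
      ; at-u₁ = w₁≢a₁ ∷ w₁≢b₁ ∷ []
      ; at-u₂ = w₂≢a₂ ∷ w₂≢b₂ ∷ []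
      ; at-u₃ = w₃≢a₃ ∷ w₃≢b₃ ∷ []
      }
    where
    v₂≢v₄ : v₂ ≢ v₄
    v₂≢v₄ refl = ∄γ (lose v₂∈L₁ (v₂-fits-v₁ , v₄∈ , v₄≢v₅ ∷ v₄≢z ∷ []))
  ... | no v₂-unfit-for-v₁
    with v₃ , v₃∈ , (v₃≢v₅ ∷ v₃≢u₃ ∷ v₃≢v₂ ∷ []) ← pick (v₅ ∷ u₃ ∷ v₂ ∷ []) S₃
    with w₃ , w₃∈ , (w₃≢u₃ ∷ w₃≢a₃ ∷ w₃≢b₃ ∷ w₃≢v₂ ∷ w₃≢v₃ ∷ []) ← pick (u₃ ∷ a₃ ∷ b₃ ∷ v₂ ∷ v₃ ∷ []) Sw₃
    with w₂ , w₂∈ , (w₂≢u₂ ∷ w₂≢a₂ ∷ w₂≢b₂ ∷ w₂≢v₂ ∷ w₂≢v₃ ∷ []) ← pick (u₂ ∷ a₂ ∷ b₂ ∷ v₂ ∷ v₃ ∷ []) Sw₂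
    with w₁ , w₁∈ , (w₁≢u₁ ∷ w₁≢a₁ ∷ w₁≢b₁ ∷ w₁≢v₂ ∷ []) ← pick (u₁ ∷ a₁ ∷ b₁ ∷ v₂ ∷ []) Sw₁
    with fits-v₁? v₃
  ... | yes (v₃∈L₁ , v₃-fits-v₁)
    with v₁ , v₁∈ , (v₁≢v₅ ∷ v₁≢u₁ ∷ v₁≢v₃ ∷ v₁≢w₁ ∷ v₁≢w₂ ∷ []) ← pick (v₅ ∷ u₁ ∷ v₃ ∷ w₁ ∷ w₂ ∷ []) S₁
    with v₆ , v₆∈ , (v₆≢v₅ ∷ v₆≢z ∷ v₆≢v₁ ∷ v₆≢v₂ ∷ v₆≢w₁ ∷ []) ← pick (v₅ ∷ z ∷ v₁ ∷ v₂ ∷ w₁ ∷ []) S₆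
    with v₄ , v₄∈ , (v₄≢v₅ ∷ v₄≢z ∷ v₄≢v₂ ∷ v₄≢w₃ ∷ v₄≢v₆ ∷ []) ← pick (v₅ ∷ z ∷ v₂ ∷ w₃ ∷ v₆ ∷ []) S₄
    = record
      { v₁ = v₁ ; v₂ = v₂ ; v₃ = v₃ ; v₄ = v₄ ; v₆ = v₆ ; w₁ = w₁ ; w₂ = w₂ ; w₃ = w₃
      ; v₁∈L₁ = v₁∈ ; v₂∈L₂ = v₂∈ ; v₃∈L₃ = v₃∈ ; v₄∈L₄ = v₄∈ ; v₆∈L₆ = v₆∈
      ; w₁∈Lw₁ = w₁∈ ; w₂∈Lw₂ = w₂∈ ; w₃∈Lw₃ = w₃∈
      ; at-v₁ = distinct₄ v₁≢v₂ (≢-sym v₆≢v₁) v₁≢w₁ (≢-sym v₆≢v₂) (≢-sym w₁≢v₂) v₆≢w₁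
      ; at-v₂ = distinct₄ (≢-sym v₁≢v₂) (≢-sym v₃≢v₂) (≢-sym w₂≢v₂) v₁≢v₃ v₁≢w₂ (≢-sym w₂≢v₃)
      ; at-v₃ = distinct₄ v₃≢v₂ v₃≢v₄ (≢-sym w₃≢v₃) (≢-sym v₄≢v₂) (≢-sym w₃≢v₂) v₄≢w₃
      ; at-v₄ = distinct₃ (≢-sym v₃≢v₄) v₄≢v₅ v₃≢v₅
      ; at-v₅ = distinct₃ v₄≢v₆ v₄≢z v₆≢z
      ; at-v₆ = distinct₃ v₆≢v₁ v₆≢v₅ v₁≢v₅
      ; at-w₁ = distinct₃ (≢-sym v₁≢w₁) w₁≢u₁ v₁≢u₁
      ; at-w₂ = distinct₃ w₂≢v₂ w₂≢u₂ v₂≢u₂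
      ; at-w₃ = distinct₃ w₃≢v₃ w₃≢u₃ v₃≢u₃
      ; at-u₁ = w₁≢a₁ ∷ w₁≢b₁ ∷ []
      ; at-u₂ = w₂≢a₂ ∷ w₂≢b₂ ∷ []
      ; at-u₃ = w₃≢a₃ ∷ w₃≢b₃ ∷ []
      }
    where
    v₁≢v₂ : v₁ ≢ v₂
    v₁≢v₂ refl = v₂-unfit-for-v₁ (v₁∈ , v₁≢v₅ ∷ v₁≢u₁ ∷ [])
    v₃≢v₄ : v₃ ≢ v₄
    v₃≢v₄ refl = ∄γ (lose v₃∈L₁ (v₃-fits-v₁ , v₄∈ , v₄≢v₅ ∷ v₄≢z ∷ []))
  ... | no v₃-unfit-for-v₁
    with v₄ , v₄∈ , (v₄≢v₅ ∷ v₄≢z ∷ v₄≢v₂ ∷ v₄≢v₃ ∷ v₄≢w₃ ∷ []) ← pick (v₅ ∷ z ∷ v₂ ∷ v₃ ∷ w₃ ∷ []) S₄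
    with v₆ , v₆∈ , (v₆≢v₅ ∷ v₆≢z ∷ v₆≢v₂ ∷ v₆≢v₄ ∷ v₆≢w₁ ∷ []) ← pick (v₅ ∷ z ∷ v₂ ∷ v₄ ∷ w₁ ∷ []) S₆
    with v₁ , v₁∈ , (v₁≢v₅ ∷ v₁≢u₁ ∷ v₁≢v₆ ∷ v₁≢w₁ ∷ v₁≢w₂ ∷ []) ← pick (v₅ ∷ u₁ ∷ v₆ ∷ w₁ ∷ w₂ ∷ []) S₁
    = record
      { v₁ = v₁ ; v₂ = v₂ ; v₃ = v₃ ; v₄ = v₄ ; v₆ = v₆ ; w₁ = w₁ ; w₂ = w₂ ; w₃ = w₃
      ; v₁∈L₁ = v₁∈ ; v₂∈L₂ = v₂∈ ; v₃∈L₃ = v₃∈ ; v₄∈L₄ = v₄∈ ; v₆∈L₆ = v₆∈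
      ; w₁∈Lw₁ = w₁∈ ; w₂∈Lw₂ = w₂∈ ; w₃∈Lw₃ = w₃∈
      ; at-v₁ = distinct₄ v₁≢v₂ v₁≢v₆ v₁≢w₁ (≢-sym v₆≢v₂) (≢-sym w₁≢v₂) v₆≢w₁
      ; at-v₂ = distinct₄ (≢-sym v₁≢v₂) (≢-sym v₃≢v₂) (≢-sym w₂≢v₂) v₁≢v₃ v₁≢w₂ (≢-sym w₂≢v₃)
      ; at-v₃ = distinct₄ v₃≢v₂ (≢-sym v₄≢v₃) (≢-sym w₃≢v₃) (≢-sym v₄≢v₂) (≢-sym w₃≢v₂) v₄≢w₃
      ; at-v₄ = distinct₃ v₄≢v₃ v₄≢v₅ v₃≢v₅
      ; at-v₅ = distinct₃ (≢-sym v₆≢v₄) v₄≢z v₆≢z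
      ; at-v₆ = distinct₃ (≢-sym v₁≢v₆) v₆≢v₅ v₁≢v₅
      ; at-w₁ = distinct₃ (≢-sym v₁≢w₁) w₁≢u₁ v₁≢u₁
      ; at-w₂ = distinct₃ w₂≢v₂ w₂≢u₂ v₂≢u₂
      ; at-w₃ = distinct₃ w₃≢v₃ w₃≢u₃ v₃≢u₃
      ; at-u₁ = w₁≢a₁ ∷ w₁≢b₁ ∷ []
      ; at-u₂ = w₂≢a₂ ∷ w₂≢b₂ ∷ []
      ; at-u₃ = w₃≢a₃ ∷ w₃≢b₃ ∷ []
      }
    where
    v₁≢v₂ : v₁ ≢ v₂
    v₁≢v₂ refl = v₂-unfit-for-v₁ (v₁∈ , v₁≢v₅ ∷ v₁≢u₁ ∷ [])
    v₁≢v₃ : v₁ ≢ v₃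
    v₁≢v₃ refl = v₃-unfit-for-v₁ (v₁∈ , v₁≢v₅ ∷ v₁≢u₁ ∷ [])

labelwise : ∀ {N} {P : Fin N → Set} → All P (allFin N) → ∀ l → P l
labelwise all l = All.lookup all (∈-allFin l)

-- S = {v₁, v₂, v₃, v₅, w}, in the label order of edgesA.
Sᴬ : Fin 8 → Bool
Sᴬ = Vec.lookup (true ∷ true ∷ true ∷ false ∷ true ∷ true ∷ false ∷ false ∷ [])

-- S = {v₁, v₂, v₃, v₄, v₆, w₁, w₂, w₃}, in the label order of edgesB.
Sᴮ : Fin 12 → Bool
Sᴮ = Vec.lookup (true ∷ true ∷ true ∷ true ∷ false ∷ true ∷ true ∷ true ∷ true ∷ false ∷ false ∷ false ∷ [])

module _ {k n} (k≥6 : 6 ≤ k) (G : Graph n) (minimal : MinimalCounterexample G k) where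

  private
    six : {L : Fin n → List ℕ} → (∀ v → Unique (L v) × k ≤ length (L v)) → ∀ v → SixColours (L v)
    six L-ok v = proj₁ (L-ok v) , ℕₚ.≤-trans k≥6 (proj₂ (L-ok v))

  minimal⇒¬ConfigA : ¬ ConfigA G
  minimal⇒¬ConfigA (f , copy , d₁ , d₂ , d₃ , d₅ , dʷ , d₄ , dᵘ , dˣ) =
    minimal⇒irreducible G inS minimal (proj₂ copy (# 0) (# 1)) (inS-f (# 0)) extend
    where
    open LabelledCopy G edgesA copy Sᴬ

    closed : ∀ l → Sᴬ l ≡ true → deg G (f l) ≡ length (conf-nbrs l)
    closed = labelwise ((λ _ → d₁) ∷ (λ _ → d₂) ∷ (λ _ → d₃) ∷ (λ ()) ∷ (λ _ → d₅) ∷ (λ _ → dʷ) ∷ (λ ()) ∷ (λ ()) ∷ [])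

    extend : Choosable3d H k → Choosable3d G k
    extend choosable (L , L-ok) = recolouring (choosable (L , L-ok))
      where
      recolouring : (∃ λ φ → Dynamic3 H φ × ∀ v → φ v ∈ L v) → ∃ λ ψ → Dynamic3 G ψ × ∀ v → ψ v ∈ L v
      recolouring (φ , φ-dynamic , φ∈L) =
        ψ , recolour-dynamic closed φ-dynamic rainbow boundary , ψ∈L L c∈L φ∈L
        where
        open Σ (outside-nbr {# 3} refl d₄) renaming (proj₁ to z; proj₂ to v₄z)
        open TwoColouredOutsideNbrs (two-coloured-outside-nbrs {# 6} refl φ-dynamic dᵘ)
          renaming (p to u₁; q to u₂; p-outside to uu₁; q-outside to uu₂; φp≢φq to φu₁≢φu₂)
        open TwoColouredOutsideNbrs (two-coloured-outside-nbrs {# 7} refl φ-dynamic dˣ)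
          renaming (p to x₁; q to x₂; p-outside to xx₁; q-outside to xx₂; φp≢φq to φx₁≢φx₂)
        open LocalColouringA (localColouringA (φ (f (# 3))) (φ (f (# 6))) (φ (f (# 7)))
                                              (φ z) (φ u₁) (φ u₂) (φ x₁) (φ x₂)
                                              (six L-ok _) (six L-ok _) (six L-ok _) (six L-ok _) (six L-ok _))
        -- the entries at v₄, u, x are never read
        c : Fin 8 → ℕ
        c = Vec.lookup (v₁ ∷ v₂ ∷ v₃ ∷ 0 ∷ v₅ ∷ w ∷ 0 ∷ 0 ∷ [])
        open Recolour φ c
        c∈L : ∀ l → Sᴬ l ≡ true → c l ∈ L (f l)
        c∈L = labelwise ((λ _ → v₁∈L₁) ∷ (λ _ → v₂∈L₂) ∷ (λ _ → v₃∈L₃) ∷ (λ ()) ∷ (λ _ → v₅∈L₅) ∷ (λ _ → w∈Lʷ)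
                         ∷ (λ ()) ∷ (λ ()) ∷ [])
        rainbow : ∀ l → Sᴬ l ≡ true → Unique (map col (l ∷ conf-nbrs l))
        rainbow = labelwise ((λ _ → at-v₁) ∷ (λ _ → at-v₂) ∷ (λ _ → at-v₃) ∷ (λ ()) ∷ (λ _ → at-v₅) ∷ (λ _ → at-w)
                             ∷ (λ ()) ∷ (λ ()) ∷ [])
        boundary : ∀ l → Sᴬ l ≡ false → 3 ⊓ deg G (f l) ≤ seenColours G ψ (f l)
        boundary = labelwise ((λ ()) ∷ (λ ()) ∷ (λ ())
          ∷ (λ _ → boundary-dynamic (# 3) (z ∷ []) (v₄z ∷ []) at-v₄ ℕₚ.≤-refl)
          ∷ (λ ()) ∷ (λ ())
          ∷ (λ _ → boundary-dynamic (# 6) (u₁ ∷ u₂ ∷ []) (uu₁ ∷ uu₂ ∷ []) (at-u ∷ distinct₂ φu₁≢φu₂) ℕₚ.≤-refl)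
          ∷ (λ _ → boundary-dynamic (# 7) (x₁ ∷ x₂ ∷ []) (xx₁ ∷ xx₂ ∷ []) (at-x ∷ distinct₂ φx₁≢φx₂) ℕₚ.≤-refl)
          ∷ [])

  minimal⇒¬ConfigB : ¬ ConfigB G
  minimal⇒¬ConfigB (f , copy , d₁ , d₂ , d₃ , d₄ , d₆ , dw₁ , dw₂ , dw₃ , d₅ , du₁ , du₂ , du₃) =
    minimal⇒irreducible G inS minimal (proj₂ copy (# 0) (# 1)) (inS-f (# 0)) extend
    where
    open LabelledCopy G edgesB copy Sᴮ

    closed : ∀ l → Sᴮ l ≡ true → deg G (f l) ≡ length (conf-nbrs l)
    closed = labelwise ((λ _ → d₁) ∷ (λ _ → d₂) ∷ (λ _ → d₃) ∷ (λ _ → d₄) ∷ (λ ()) ∷ (λ _ → d₆)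
                        ∷ (λ _ → dw₁) ∷ (λ _ → dw₂) ∷ (λ _ → dw₃) ∷ (λ ()) ∷ (λ ()) ∷ (λ ()) ∷ [])

    extend : Choosable3d H k → Choosable3d G k
    extend choosable (L , L-ok) = recolouring (choosable (L , L-ok))
      where
      recolouring : (∃ λ φ → Dynamic3 H φ × ∀ v → φ v ∈ L v) → ∃ λ ψ → Dynamic3 G ψ × ∀ v → ψ v ∈ L v
      recolouring (φ , φ-dynamic , φ∈L) =
        ψ , recolour-dynamic closed φ-dynamic rainbow boundary , ψ∈L L c∈L φ∈L
        where
        open Σ (outside-nbr {# 4} refl d₅) renaming (proj₁ to z; proj₂ to v₅z)
        open TwoColouredOutsideNbrs (two-coloured-outside-nbrs {# 9} refl φ-dynamic du₁)
          renaming (p to p₁; q to q₁; p-outside to u₁p₁; q-outside to u₁q₁; φp≢φq to φp₁≢φq₁)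
        open TwoColouredOutsideNbrs (two-coloured-outside-nbrs {# 10} refl φ-dynamic du₂)
          renaming (p to p₂; q to q₂; p-outside to u₂p₂; q-outside to u₂q₂; φp≢φq to φp₂≢φq₂)
        open TwoColouredOutsideNbrs (two-coloured-outside-nbrs {# 11} refl φ-dynamic du₃)
          renaming (p to p₃; q to q₃; p-outside to u₃p₃; q-outside to u₃q₃; φp≢φq to φp₃≢φq₃)
        open LocalColouringB (localColouringB (φ (f (# 4))) (φ (f (# 9))) (φ (f (# 10))) (φ (f (# 11)))
                                              (φ z) (φ p₁) (φ q₁) (φ p₂) (φ q₂) (φ p₃) (φ q₃)
                                              (six L-ok _) (six L-ok _) (six L-ok _) (six L-ok _)
                                              (six L-ok _) (six L-ok _) (six L-ok _) (six L-ok _))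
        c : Fin 12 → ℕ
        c = Vec.lookup (v₁ ∷ v₂ ∷ v₃ ∷ v₄ ∷ 0 ∷ v₆ ∷ w₁ ∷ w₂ ∷ w₃ ∷ 0 ∷ 0 ∷ 0 ∷ [])
        open Recolour φ c
        c∈L : ∀ l → Sᴮ l ≡ true → c l ∈ L (f l)
        c∈L = labelwise ((λ _ → v₁∈L₁) ∷ (λ _ → v₂∈L₂) ∷ (λ _ → v₃∈L₃) ∷ (λ _ → v₄∈L₄) ∷ (λ ()) ∷ (λ _ → v₆∈L₆)
                         ∷ (λ _ → w₁∈Lw₁) ∷ (λ _ → w₂∈Lw₂) ∷ (λ _ → w₃∈Lw₃) ∷ (λ ()) ∷ (λ ()) ∷ (λ ()) ∷ [])
        rainbow : ∀ l → Sᴮ l ≡ true → Unique (map col (l ∷ conf-nbrs l))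
        rainbow = labelwise ((λ _ → at-v₁) ∷ (λ _ → at-v₂) ∷ (λ _ → at-v₃) ∷ (λ _ → at-v₄) ∷ (λ ()) ∷ (λ _ → at-v₆)
                             ∷ (λ _ → at-w₁) ∷ (λ _ → at-w₂) ∷ (λ _ → at-w₃) ∷ (λ ()) ∷ (λ ()) ∷ (λ ()) ∷ [])
        boundary : ∀ l → Sᴮ l ≡ false → 3 ⊓ deg G (f l) ≤ seenColours G ψ (f l)
        boundary = labelwise ((λ ()) ∷ (λ ()) ∷ (λ ()) ∷ (λ ())
          ∷ (λ _ → boundary-dynamic (# 4) (z ∷ []) (v₅z ∷ []) at-v₅ ℕₚ.≤-refl)
          ∷ (λ ()) ∷ (λ ()) ∷ (λ ()) ∷ (λ ())
          ∷ (λ _ → boundary-dynamic (# 9) (p₁ ∷ q₁ ∷ []) (u₁p₁ ∷ u₁q₁ ∷ []) (at-u₁ ∷ distinct₂ φp₁≢φq₁) ℕₚ.≤-refl)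
          ∷ (λ _ → boundary-dynamic (# 10) (p₂ ∷ q₂ ∷ []) (u₂p₂ ∷ u₂q₂ ∷ []) (at-u₂ ∷ distinct₂ φp₂≢φq₂) ℕₚ.≤-refl)
          ∷ (λ _ → boundary-dynamic (# 11) (p₃ ∷ q₃ ∷ []) (u₃p₃ ∷ u₃q₃ ∷ []) (at-u₃ ∷ distinct₂ φp₃≢φq₃) ℕₚ.≤-refl)
          ∷ [])

lemma2p3 : (k : ℕ) → 6 ≤ k → ∀ {n} (G : Graph n) → MinimalCounterexample G k →
    ¬ ConfigA G × ¬ ConfigB G
lemma2p3 k k≥6 G minimal = minimal⇒¬ConfigA k≥6 G minimal , minimal⇒¬ConfigB k≥6 G minimal
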